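{- Let $N$ be a finite BSR(SLI) clause set in normal form such that, if the constant symbol $c_{+\infty}$ occurs in $N$, then $\Psi^{+\infty}_N\subseteq N$. Suppose some clause $C\in N$ contains a base-sort variable $x$, and let $\hat N_x := (N\setminus\{C\}) \cup \{C\{x/c\} : c\in\mathcal{I}_{\uparrow_N(x)}\} \cup \Psi^{+\infty}_N$. Then $N$ is satisfiable if and only if $\hat N_x$ is satisfiable.
   Context: Setting: base sort $\mathcal{Z}$ interpreted as $\mathbb{Z}$, free sort $\mathcal{S}$. BSR(SLI) clauses $\Lambda\,\|\,\Gamma\to\Delta$: $\Lambda$ is a multiset of LIA constraints $s\triangleleft t$, $x\triangleleft t$, $x\trianglelefteq y$ ($s,t$ ground LIA terms built from integers, $+,-$ and base-sort Skolem constants; $x,y$ base-sort variables; $\triangleleft\in\{<,\le,=,\neq,\ge,>\}$, $\trianglelefteq\in\{\le,=,\ge\}$); $\Gamma,\Delta$ are multisets of free-sort equations $s\approx s'$ between free-sort variables or constants, or atoms $P(s_1,\dots,s_m)$ of uninterpreted sorted predicates whose base-sort arguments are variables and free-sort arguments are variables or free-sort constants; the clause means $(\bigwedge\Lambda\wedge\bigwedge\Gamma)\to\bigvee\Delta$, universally closed. Satisfiability is w.r.t. hierarchic interpretations (base sort is $\mathbb{Z}$ with standard arithmetic, Skolem constants get integer values, free sort nonempty, predicates and free constants interpreted freely). Normal form of a clause set: every non-ground atom of $\Lambda$ is $x\trianglelefteq c$ ($c$ an integer or Skolem constant, $\trianglelefteq\in\{\le,=,\ge\}$) or $x\le y$ (or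 symmetric variants); base-sort variables of $\Lambda$ occur in $\Gamma\to\Delta$; $\Gamma$ contains no $u\approx t$ with $u$ a free-sort variable; clauses pairwise variable-disjoint; at least one free-sort constant occurs. $\sqsubseteq_N$ is the smallest reflexive, transitive relation on argument positions $\langle P,i\rangle$ with $\langle Q,j\rangle\sqsubseteq_N\langle P,i\rangle$ whenever some clause of $N$ contains $Q(\dots,u,\dots)$ ($u$ at position $j$) and $P(\dots,v,\dots)$ ($v$ at position $i$) with $u=v$, or with $u\ne v$ base-sort and $u=v$ or $u\le v$ in $\Lambda$, or with $u\ne v$ free-sort and $u\approx v$ in $\Gamma$ or $\Delta$ (free-sort variables $v$ occurring only in equations are treated as if $\Delta$ contained $\mathit{False}_v(v)$ for a fresh predicate). $\uparrow_N\langle P,i\rangle := \{\langle Q,j\rangle:\langle P,i\rangle\sqsubseteq_N\langle Q,j\rangle\}$; for a variable $x$ occurring as $i$-th argument of an atom $P(\dots)$ in $N$, $\uparrow_N(x):=\uparrow_N\langle P,i\rangle$. For a base-sort position, $\mathcal{I}^{\mathrm{dual}}_{P,i}$ is the set of constant symbols $d$ such that some clause of $N$ contains an atom $P(\dots,x,\dots)$ with $x$ as $i$-th argument and a constraint $x=d$ or $x\le d$; $\mathcal{I}_{\uparrow_N\langle P,i\rangle} := \{c_{+\infty}\}\cup\bigcup_{\langle Q,j\rangle\in\uparrow_N\langle P,i\rangle}\mathcal{I}^{\mathrm{dual}}_{Q,j}$, where $c_{+\infty}$ is a distinguished base-sort constant symbol. $\Psi^{+\infty}_N := \{(c_{+\infty}\le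 c \,\|\, \to \Box) : c \text{ a base-sort constant symbol occurring in } N,\ c\ne c_{+\infty}\}$ (i.e. the axioms $c_{+\infty}>c$), $\Box$ denoting the empty disjunction. For a base-sort variable $x$ and base-sort constant $c$, $(\Lambda\,\|\,\Gamma\to\Delta)\{x/c\} := \Lambda\{x/c\}, x=c \,\|\, \Gamma\to\Delta$. -}

module Defs where

open import Level using (Level; suc; zero)
open import Data.Nat using (ℕ) renaming (_≟_ to _≟ℕ_)
open import Data.Integer using (ℤ; _+_; _-_; -_; _<_; _≤_)
open import Data.Bool using (Bool; true; false; if_then_else_)
open import Data.Maybe using (Maybe; just; nothing)
open import Data.List using (List; []; _∷_; _++_; map; [_])
open import Data.List.Membership.Propositional using (_∈_)
open import Data.List.Relation.Unary.All using (All)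
open import Data.List.Relation.Unary.Any using (Any)
open import Data.Product using (Σ; _×_; _,_)
open import Data.Sum using (_⊎_; inj₁; inj₂)
open import Data.Unit using (⊤)
open import Relation.Nullary using (¬_; does)
open import Relation.Binary.PropositionalEquality using (_≡_; _≢_)
open import Relation.Binary.Construct.Closure.ReflexiveTransitive using (Star)

-- base-sort constant symbols: integer literals, Skolem constants, and
-- the distinguished Skolem constant c₊∞
data BConst : Set where
  int : ℤ → BConst
  sk  : ℕ → BConst
  c₊∞ : BConst

data GTerm : Set where
  con  : BConst → GTerm
  _⊕_  : GTerm → GTerm → GTerm
  _⊖_  : GTerm → GTerm → GTerm
  ⊝_   : GTerm → GTerm

data Rel : Set where
  lt le eq ne ge gt : Rel

data WRel : Set where
  wle weq wge : WRel

toRel : WRel → Rel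
toRel wle = le
toRel weq = eq
toRel wge = ge

flipRel : Rel → Rel
flipRel lt = gt
flipRel le = ge
flipRel eq = eq
flipRel ne = ne
flipRel ge = le
flipRel gt = lt

-- LIA constraints; base-sort variables are named by ℕ.
-- Symmetric variants (t ◁ x) are represented as x (flipRel ◁) t.
data LAtom : Set where
  gnd : Rel → GTerm → GTerm → LAtom
  vt  : Rel → ℕ → GTerm → LAtom
  vv  : WRel → ℕ → ℕ → LAtom

data FTerm : Set where
  fvar : ℕ → FTerm
  fcon : ℕ → FTerm

data Arg : Set where
  barg : ℕ → Arg
  farg : FTerm → Arg

data FAtom : Set where
  _≈ᶠ_ : FTerm → FTerm → FAtom
  app  : ℕ → List Arg → FAtom

record Clause : Set where
  constructor _‖_⇒_
  field
    Λ : List LAtom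
    Γ : List FAtom
    Δ : List FAtom
open Clause public

ClauseSet : Set₁
ClauseSet = Clause → Set

data Sort : Set where
  baseS freeS : Sort

argSort : Arg → Sort
argSort (barg _) = baseS
argSort (farg _) = freeS

record Interp : Set₁ where
  field
    U     : Set
    u₀    : U                -- nonempty
    skol  : ℕ → ℤ
    inf   : ℤ
    fc    : ℕ → U
    pr    : ℕ → List (ℤ ⊎ U) → Bool
open Interp public

module _ (I : Interp) where
  evalC : BConst → ℤ
  evalC (int z) = z
  evalC (sk n)  = skol I n
  evalC c₊∞     = inf I

  evalG : GTerm → ℤ
  evalG (con c) = evalC c
  evalG (s ⊕ t) = evalG s + evalG t
  evalG (s ⊖ t) = evalG s - evalG t
  evalG (⊝ s)   = - evalG s

  relSem : Rel → ℤ → ℤ → Set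
  relSem lt a b = a < b
  relSem le a b = a ≤ b
  relSem eq a b = a ≡ b
  relSem ne a b = a ≢ b
  relSem ge a b = b ≤ a
  relSem gt a b = b < a

  module _ (β : ℕ → ℤ) (γ : ℕ → U I) where
    ⟦_⟧L : LAtom → Set
    ⟦ gnd r s t ⟧L = relSem r (evalG s) (evalG t)
    ⟦ vt r x t ⟧L  = relSem r (β x) (evalG t)
    ⟦ vv r x y ⟧L  = relSem (toRel r) (β x) (β y)

    evalF : FTerm → U I
    evalF (fvar v) = γ v
    evalF (fcon k) = fc I k

    evalA : Arg → ℤ ⊎ U I
    evalA (barg x) = inj₁ (β x)
    evalA (farg t) = inj₂ (evalF t)

    ⟦_⟧F : FAtom → Set
    ⟦ s ≈ᶠ t ⟧F    = evalF s ≡ evalF t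
    ⟦ app P as ⟧F  = pr I P (map evalA as) ≡ true

    ClauseTrue : Clause → Set
    ClauseTrue C = All ⟦_⟧L (Λ C) → All ⟦_⟧F (Γ C) → Any ⟦_⟧F (Δ C)

  Models : ClauseSet → Set
  Models S = ∀ C → S C → (β : ℕ → ℤ) (γ : ℕ → U I) → ClauseTrue β γ C

Satisfiable : ClauseSet → Set₁
Satisfiable S = Σ Interp λ I → Models I S

setOf : List Clause → ClauseSet
setOf N C = C ∈ N

data Var : Set where
  bv : ℕ → Var
  fv : ℕ → Var

varArg : Var → Arg
varArg (bv x) = barg x
varArg (fv v) = farg (fvar v)

_‼_ : {A : Set} → List A → ℕ → Maybe A
[] ‼ _ = nothing
(a ∷ as) ‼ 0 = just a
(a ∷ as) ‼ ℕ.suc n = as ‼ n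

atomsOf : Clause → List FAtom
atomsOf C = Γ C ++ Δ C

data ConstInG (c : BConst) : GTerm → Set where
  here  : ConstInG c (con c)
  ⊕ˡ : ∀ {s t} → ConstInG c s → ConstInG c (s ⊕ t)
  ⊕ʳ : ∀ {s t} → ConstInG c t → ConstInG c (s ⊕ t)
  ⊖ˡ : ∀ {s t} → ConstInG c s → ConstInG c (s ⊖ t)
  ⊖ʳ : ∀ {s t} → ConstInG c t → ConstInG c (s ⊖ t)
  ⊝∙ : ∀ {s} → ConstInG c s → ConstInG c (⊝ s)

ConstInL : BConst → LAtom → Set
ConstInL c (gnd _ s t) = ConstInG c s ⊎ ConstInG c t
ConstInL c (vt _ _ t)  = ConstInG c t
ConstInL c (vv _ _ _)  = Data.Empty.⊥
  where import Data.Empty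

ConstOccurs : BConst → List Clause → Set
ConstOccurs c N = Σ Clause λ C → C ∈ N × Any (ConstInL c) (Λ C)

FConstInT : FTerm → Set
FConstInT (fvar _) = Data.Empty.⊥
  where import Data.Empty
FConstInT (fcon _) = ⊤

FConstInAtom : FAtom → Set
FConstInAtom (s ≈ᶠ t)  = FConstInT s ⊎ FConstInT t
FConstInAtom (app _ as) = Any (λ { (barg _) → Data.Empty.⊥ ; (farg t) → FConstInT t }) as
  where import Data.Empty

VarInL : Var → LAtom → Set
VarInL v (gnd _ _ _) = Data.Empty.⊥
  where import Data.Empty
VarInL v (vt _ x _)  = v ≡ bv x
VarInL v (vv _ x y)  = v ≡ bv x ⊎ v ≡ bv y

VarInT : Var → FTerm → Set
VarInT v (fvar w) = v ≡ fv w
VarInT v (fcon _) = Data.Empty.⊥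
  where import Data.Empty

VarInArg : Var → Arg → Set
VarInArg v (barg x) = v ≡ bv x
VarInArg v (farg t) = VarInT v t

VarInEq : Var → FAtom → Set
VarInEq v (s ≈ᶠ t)  = VarInT v s ⊎ VarInT v t
VarInEq v (app _ _) = Data.Empty.⊥
  where import Data.Empty

VarInPred : Var → FAtom → Set
VarInPred v (_ ≈ᶠ _)   = Data.Empty.⊥
  where import Data.Empty
VarInPred v (app _ as) = Any (VarInArg v) as

VarIn : Var → Clause → Set
VarIn v C = Any (VarInL v) (Λ C) ⊎ Any (VarInEq v) (atomsOf C) ⊎ Any (VarInPred v) (atomsOf C)

IsFVar : FTerm → Set
IsFVar t = Σ ℕ λ v → t ≡ fvar v

WellSorted : (ℕ → List Sort) → List Clause → Set
WellSorted ar N = ∀ C → C ∈ N → ∀ P as → app P as ∈ atomsOf C → map argSort as ≡ ar P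

NFAtom : LAtom → Set
NFAtom (gnd _ _ _) = ⊤
NFAtom (vt r _ t)  = (r ≡ le ⊎ r ≡ eq ⊎ r ≡ ge) × Σ BConst (λ c → t ≡ con c)
NFAtom (vv r _ _)  = r ≡ wle ⊎ r ≡ wge

record NormalForm (N : List Clause) : Set where
  field
    nfAtoms   : ∀ C → C ∈ N → All NFAtom (Λ C)
    nfVars    : ∀ C → C ∈ N → ∀ x → Any (VarInL (bv x)) (Λ C) →
                Any (VarInPred (bv x)) (atomsOf C)
    nfΓ       : ∀ C → C ∈ N → ∀ s t → (s ≈ᶠ t) ∈ Γ C → ¬ IsFVar s × ¬ IsFVar t
    nfDisj    : ∀ C D → C ∈ N → D ∈ N → C ≢ D → ∀ v → VarIn v C → ¬ VarIn v D
    nfFConst  : Σ Clause λ C → C ∈ N × Any FConstInAtom (atomsOf C)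

-- predicate symbols, together with the fresh predicates False_v
-- (one per free-sort variable v occurring only in equations)
data Sym : Set where
  pred   : ℕ → Sym
  falseV : ℕ → Sym

Pos : Set
Pos = Sym × ℕ     -- ⟨P , i⟩, argument index i counted from 0

OccAt : Clause → Pos → Var → Set
OccAt C (pred P , i) v =
  Σ (List Arg) λ as → app P as ∈ atomsOf C × as ‼ i ≡ just (varArg v)
OccAt C (falseV w , i) v =
  v ≡ fv w × i ≡ 0 × Any (VarInEq (fv w)) (atomsOf C) × ¬ Any (VarInPred (fv w)) (atomsOf C)

Linked : Clause → Var → Var → Set
Linked C u v =
  u ≡ v
  ⊎ (Σ ℕ λ a → Σ ℕ λ b → u ≡ bv a × v ≡ bv b ×
       (vv weq a b ∈ Λ C ⊎ vv weq b a ∈ Λ C ⊎ vv wle a b ∈ Λ C ⊎ vv wge b a ∈ Λ C))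
  ⊎ (Σ ℕ λ a → Σ ℕ λ b → u ≡ fv a × v ≡ fv b ×
       ((fvar a ≈ᶠ fvar b) ∈ atomsOf C ⊎ (fvar b ≈ᶠ fvar a) ∈ atomsOf C))

Step : List Clause → Pos → Pos → Set
Step N q p = Σ Clause λ C → C ∈ N × Σ Var λ u → Σ Var λ v →
  OccAt C q u × OccAt C p v × Linked C u v

_⊑[_]_ : Pos → List Clause → Pos → Set
q ⊑[ N ] p = Star (Step N) q p

↑ : List Clause → Pos → Pos → Set
↑ N p q = p ⊑[ N ] q

IDual : List Clause → Pos → BConst → Set
IDual N q d = Σ Clause λ C → C ∈ N × Σ ℕ λ x → OccAt C q (bv x) ×
  (vt eq x (con d) ∈ Λ C ⊎ vt le x (con d) ∈ Λ C)

I↑ : List Clause → Pos → BConst → Set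
I↑ N p d = d ≡ c₊∞ ⊎ Σ Pos λ q → ↑ N p q × IDual N q d

psi : BConst → Clause
psi c = [ gnd le (con c₊∞) (con c) ] ‖ [] ⇒ []

Ψ : List Clause → ClauseSet
Ψ N D = Σ BConst λ c → ConstOccurs c N × c ≢ c₊∞ × D ≡ psi c

_==_ : ℕ → ℕ → Bool
a == b = does (a ≟ℕ b)

substL : ℕ → BConst → LAtom → LAtom
substL x c (gnd r s t) = gnd r s t
substL x c (vt r y t)  = if y == x then gnd r (con c) t else vt r y t
substL x c (vv r y z)  with y == x | z == x
... | true  | true  = gnd (toRel r) (con c) (con c)
... | true  | false = vt (flipRel (toRel r)) z (con c)
... | false | true  = vt (toRel r) y (con c)
... | false | false = vv r y z

inst : Clause → ℕ → BConst → Clause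
inst C x c = (map (substL x c) (Λ C) ++ [ vt eq x (con c) ]) ‖ Γ C ⇒ Δ C

-- N̂_x = (N ∖ {C}) ∪ {C{x/c} : c ∈ I_{↑_N(x)}} ∪ Ψ^{+∞}_N, where ↑_N(x) = ↑_N p
N̂ : List Clause → Clause → ℕ → Pos → ClauseSet
N̂ N C x p D =
  (D ∈ N × D ≢ C)
  ⊎ (Σ BConst λ c → I↑ N p c × D ≡ inst C x c)
  ⊎ Ψ N D

module Submission where

-- Every instance C{x/c} is a consequence of C, and the axioms Ψ either already belong to N or,
-- when c₊∞ does not occur in N, become true once c₊∞ is reinterpreted above every constant of N.
-- So a model of N yields a model of N̂.
--
-- Conversely, let M be a model of N̂. Let every predicate of the new model M↑ read a base-sort
-- argument a at position q as roundUp q a: the least value ≥ a of a constant of I^dual_q′ for some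
-- q′ ∈ ↑q, or the value of c₊∞ if there is none. A clause of N is then true in M↑ under β as soon as
-- it is true in M under the rounded assignment. Rounding respects the normal-form constraints: x ≤ d
-- and x = d because d is itself a candidate; x ≥ d because the rounded value is either a candidate
-- above x or c₊∞, which Ψ puts above every constant; x ≤ y because it makes the positions of x
-- ⊑_N-below those of y, and rounding is monotone along ⊑_N. Finally the rounded value of x is the
-- value of some c ∈ I_↑(x), so C holds by its instance C{x/c} ∈ N̂.

open import Defs
open import Data.Nat as ℕ using (ℕ; suc; _<_; z<s; s<s)
open import Data.Nat.Properties using (≡ᵇ⇒≡)
open import Data.Integer as ℤ using (ℤ; _≤_; _⊓_; _⊔_; 0ℤ)
open import Data.Integer.Properties as ℤ using (≤-refl; ≤-trans; ≤-antisym; ≤-reflexive)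
open import Data.Bool using (Bool; true; false; T)
open import Data.Unit using (tt)
open import Data.Maybe using (just)
open import Data.List using (List; []; _∷_; _++_; [_]; map; concatMap; upTo; length; cartesianProduct)
open import Data.List.Properties as List using (map-cong)
open import Data.List.Relation.Unary.All as All using (All; []; _∷_)
open import Data.List.Relation.Unary.All.Properties using (++⁺; ++⁻; map⁺; map⁻)
open import Data.List.Relation.Unary.Any using (Any; here; there; any?)
open import Data.List.Relation.Unary.Any.Properties using (¬Any[])
open import Data.List.Membership.Propositional using (_∈_; find; lose)
open import Data.List.Membership.Propositional.Properties
  using (∈-++⁺ˡ; ∈-++⁺ʳ; ∈-map⁺; ∈-upTo⁺; ∈-concatMap⁺; ∈-concatMap⁻; ∈-cartesianProduct⁺)
import Data.List.Membership.DecPropositional as DecMembership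
open import Data.Product using (∃; ∃₂; _×_; _,_; proj₁; proj₂)
import Data.Product.Properties as Product
import Data.List.Extrema ℤ.≤-totalOrder as Extrema
open import Data.Sum using (_⊎_; inj₁; inj₂; [_,_]′) renaming (map to map⊎)
open import Data.Empty using (⊥-elim)
open import Function using (_∘_; id)
open import Function.Bundles using (_⇔_; mk⇔; Equivalence)
open import Relation.Nullary using (Dec; yes; no; ¬_)
open import Relation.Nullary.Decidable using (map′; _×-dec_; _⊎-dec_; ¬?)
open import Relation.Unary using (Decidable)
open import Relation.Binary.Definitions using (DecidableEquality)
open import Relation.Binary.PropositionalEquality using (_≡_; _≢_; refl; sym; trans; cong; cong₂; subst; subst₂)
open import Relation.Binary.Construct.Closure.ReflexiveTransitive using (Star; ε; _◅_; _◅◅_)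

∃∈? : {A : Set} {P : A → Set} (xs : List A) → Decidable P → Dec (∃ λ x → x ∈ xs × P x)
∃∈? xs P? = map′ find (λ (_ , x∈xs , px) → lose x∈xs px) (any? P? xs)

module _ {A : Set} {P Q : A → Set} {xs : List A} (f : ∀ {x} → x ∈ xs → P x → Q x) where

  All-map∈ : All P xs → All Q xs
  All-map∈ ps = All.tabulate λ x∈ → f x∈ (All.lookup ps x∈)

  Any-map∈ : Any P xs → Any Q xs
  Any-map∈ p = let _ , x∈ , px = find p in lose x∈ (f x∈ px)

module _ {A : Set} where

  ‼-length : ∀ (as : List A) j {a} → as ‼ j ≡ just a → j < length as
  ‼-length (_ ∷ _) 0 _ = z<s
  ‼-length (_ ∷ as) (suc j) e = s<s (‼-length as j e)

  ‼-∈ : ∀ (as : List A) j {a} → as ‼ j ≡ just a → a ∈ as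
  ‼-∈ (_ ∷ _) 0 refl = here refl
  ‼-∈ (_ ∷ as) (suc j) e = there (‼-∈ as j e)

  ∈-‼ : ∀ {as : List A} {a} → a ∈ as → ∃ λ j → as ‼ j ≡ just a
  ∈-‼ (here refl) = 0 , refl
  ∈-‼ (there a∈) = let j , e = ∈-‼ a∈ in suc j , e

module Reachability {A : Set} (_≟_ : DecidableEquality A)
                    {R : A → A → Set} (R? : ∀ a b → Dec (R a b)) where

  -- Paths whose intermediate vertices lie in S; deciding them by induction
  -- on S is the Floyd–Warshall recursion.
  data Path (S : List A) : A → A → Set where
    stay : ∀ {p} → Path S p p
    edge : ∀ {p q} → R p q → Path S p q
    _◅[_]_ : ∀ {p r q} → R p r → r ∈ S → Path S r q → Path S p q

  _++ᴾ[_]_ : ∀ {S p r q} → Path S p r → r ∈ S → Path S r q → Path S p q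
  stay ++ᴾ[ _ ] π = π
  edge e ++ᴾ[ r∈S ] π = e ◅[ r∈S ] π
  (e ◅[ s∈S ] ρ) ++ᴾ[ r∈S ] π = e ◅[ s∈S ] (ρ ++ᴾ[ r∈S ] π)

  widen : ∀ {s S p q} → Path S p q → Path (s ∷ S) p q
  widen stay = stay
  widen (edge e) = edge e
  widen (e ◅[ r∈S ] π) = e ◅[ there r∈S ] widen π

  avoid-or-visit : ∀ {s S p q} → Path (s ∷ S) p q → Path S p q ⊎ (Path S p s × Path S s q)
  avoid-or-visit stay = inj₁ stay
  avoid-or-visit (edge e) = inj₁ (edge e)
  avoid-or-visit (e ◅[ here refl ] π) with avoid-or-visit π
  ... | inj₁ π′ = inj₂ (edge e , π′)
  ... | inj₂ (_ , π′) = inj₂ (edge e , π′)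
  avoid-or-visit (e ◅[ there r∈S ] π) with avoid-or-visit π
  ... | inj₁ π′ = inj₁ (e ◅[ r∈S ] π′)
  ... | inj₂ (π₁ , π₂) = inj₂ (e ◅[ r∈S ] π₁ , π₂)

  Path? : ∀ S p q → Dec (Path S p q)
  Path? [] p q with p ≟ q | R? p q
  ... | yes refl | _ = yes stay
  ... | no _ | yes e = yes (edge e)
  ... | no p≢q | no ¬e = no λ { stay → p≢q refl ; (edge e) → ¬e e }
  Path? (s ∷ S) p q with Path? S p q | Path? S p s | Path? S s q
  ... | yes π | _ | _ = yes (widen π)
  ... | no _ | yes π₁ | yes π₂ = yes (widen π₁ ++ᴾ[ here refl ] widen π₂)
  ... | no ¬π | no ¬π₁ | _ = no λ π → [ ¬π , ¬π₁ ∘ proj₁ ]′ (avoid-or-visit π)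
  ... | no ¬π | yes _ | no ¬π₂ = no λ π → [ ¬π , ¬π₂ ∘ proj₂ ]′ (avoid-or-visit π)

  module _ (V : List A) (target∈V : ∀ {p q} → R p q → q ∈ V) where

    Star⇒Path : ∀ {p q} → Star R p q → Path V p q
    Star⇒Path ε = stay
    Star⇒Path (e ◅ π) = e ◅[ target∈V e ] Star⇒Path π

    Path⇒Star : ∀ {S p q} → Path S p q → Star R p q
    Path⇒Star stay = ε
    Path⇒Star (edge e) = e ◅ ε
    Path⇒Star (e ◅[ _ ] π) = e ◅ Path⇒Star π

    Star? : ∀ p q → Dec (Star R p q)
    Star? p q = map′ Path⇒Star Star⇒Path (Path? V p q)

module Least {X : Set} (val : X → ℤ) {G : X → Set} (G? : Decidable G) (top : ℤ) where

  least : List X → ℤ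
  least [] = top
  least (x ∷ xs) with G? x
  ... | yes _ = val x ⊓ least xs
  ... | no _ = least xs

  least-≤-top : ∀ xs → least xs ≤ top
  least-≤-top [] = ≤-refl
  least-≤-top (x ∷ xs) with G? x
  ... | yes _ = ≤-trans (ℤ.i⊓j≤j (val x) _) (least-≤-top xs)
  ... | no _ = least-≤-top xs

  least-≤ : ∀ {x} xs → x ∈ xs → G x → least xs ≤ val x
  least-≤ (y ∷ xs) x∈ gx with G? y
  least-≤ (y ∷ xs) (here refl) gx | yes _ = ℤ.i⊓j≤i (val y) _
  least-≤ (y ∷ xs) (there x∈) gx | yes _ = ≤-trans (ℤ.i⊓j≤j (val y) _) (least-≤ xs x∈ gx)
  least-≤ (y ∷ xs) (here refl) gx | no ¬gy = ⊥-elim (¬gy gx)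
  least-≤ (y ∷ xs) (there x∈) gx | no _ = least-≤ xs x∈ gx

  least-attained : ∀ xs → least xs ≡ top ⊎ ∃ λ x → x ∈ xs × G x × least xs ≡ val x
  least-attained [] = inj₁ refl
  least-attained (y ∷ xs) with G? y
  ... | no _ = map⊎ id (λ (x , x∈ , gx , e) → x , there x∈ , gx , e) (least-attained xs)
  ... | yes gy with ℤ.⊓-sel (val y) (least xs)
  ...   | inj₁ e = inj₂ (y , here refl , gy , e)
  ...   | inj₂ e = map⊎ (trans e) (λ (x , x∈ , gx , e′) → x , there x∈ , gx , trans e e′) (least-attained xs)

module SyntaxEquality where

  infix 4 _≟B_ _≟G_ _≟R_ _≟W_ _≟L_ _≟T_ _≟A_ _≟F_ _≟C_ _≟V_ _≟S_ _≟P_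

  _≟B_ : DecidableEquality BConst
  int a ≟B int b = map′ (cong int) (λ { refl → refl }) (a ℤ.≟ b)
  sk a ≟B sk b = map′ (cong sk) (λ { refl → refl }) (a ℕ.≟ b)
  c₊∞ ≟B c₊∞ = yes refl
  int _ ≟B sk _ = no λ ()
  int _ ≟B c₊∞ = no λ ()
  sk _ ≟B int _ = no λ ()
  sk _ ≟B c₊∞ = no λ ()
  c₊∞ ≟B int _ = no λ ()
  c₊∞ ≟B sk _ = no λ ()

  _≟G_ : DecidableEquality GTerm
  con a ≟G con b = map′ (cong con) (λ { refl → refl }) (a ≟B b)
  (s ⊕ t) ≟G (s′ ⊕ t′) = map′ (λ { (refl , refl) → refl }) (λ { refl → refl , refl }) (s ≟G s′ ×-dec t ≟G t′)
  (s ⊖ t) ≟G (s′ ⊖ t′) = map′ (λ { (refl , refl) → refl }) (λ { refl → refl , refl }) (s ≟G s′ ×-dec t ≟G t′)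
  (⊝ s) ≟G (⊝ s′) = map′ (cong ⊝_) (λ { refl → refl }) (s ≟G s′)
  con _ ≟G (_ ⊕ _) = no λ ()
  con _ ≟G (_ ⊖ _) = no λ ()
  con _ ≟G (⊝ _) = no λ ()
  (_ ⊕ _) ≟G con _ = no λ ()
  (_ ⊕ _) ≟G (_ ⊖ _) = no λ ()
  (_ ⊕ _) ≟G (⊝ _) = no λ ()
  (_ ⊖ _) ≟G con _ = no λ ()
  (_ ⊖ _) ≟G (_ ⊕ _) = no λ ()
  (_ ⊖ _) ≟G (⊝ _) = no λ ()
  (⊝ _) ≟G con _ = no λ ()
  (⊝ _) ≟G (_ ⊕ _) = no λ ()
  (⊝ _) ≟G (_ ⊖ _) = no λ ()

  relCode : Rel → ℕ
  relCode lt = 0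
  relCode le = 1
  relCode eq = 2
  relCode ne = 3
  relCode ge = 4
  relCode gt = 5

  relDecode : ℕ → Rel
  relDecode 0 = lt
  relDecode 1 = le
  relDecode 2 = eq
  relDecode 3 = ne
  relDecode 4 = ge
  relDecode _ = gt

  relDecode-relCode : ∀ r → relDecode (relCode r) ≡ r
  relDecode-relCode lt = refl
  relDecode-relCode le = refl
  relDecode-relCode eq = refl
  relDecode-relCode ne = refl
  relDecode-relCode ge = refl
  relDecode-relCode gt = refl

  _≟R_ : DecidableEquality Rel
  r ≟R s = map′ code-injective (cong relCode) (relCode r ℕ.≟ relCode s)
    where
    code-injective : relCode r ≡ relCode s → r ≡ s
    code-injective e = trans (sym (relDecode-relCode r)) (trans (cong relDecode e) (relDecode-relCode s))

  _≟W_ : DecidableEquality WRel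
  r ≟W s = map′ toRel-injective (cong toRel) (toRel r ≟R toRel s)
    where
    toRel-injective : ∀ {r s} → toRel r ≡ toRel s → r ≡ s
    toRel-injective {wle} {wle} _ = refl
    toRel-injective {weq} {weq} _ = refl
    toRel-injective {wge} {wge} _ = refl
    toRel-injective {wle} {weq} ()
    toRel-injective {wle} {wge} ()
    toRel-injective {weq} {wle} ()
    toRel-injective {weq} {wge} ()
    toRel-injective {wge} {wle} ()
    toRel-injective {wge} {weq} ()

  _≟L_ : DecidableEquality LAtom
  gnd r s t ≟L gnd r′ s′ t′ =
    map′ (λ { (refl , refl , refl) → refl }) (λ { refl → refl , refl , refl })
         (r ≟R r′ ×-dec s ≟G s′ ×-dec t ≟G t′)
  vt r y t ≟L vt r′ y′ t′ =
    map′ (λ { (refl , refl , refl) → refl }) (λ { refl → refl , refl , refl })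
         (r ≟R r′ ×-dec y ℕ.≟ y′ ×-dec t ≟G t′)
  vv r y z ≟L vv r′ y′ z′ =
    map′ (λ { (refl , refl , refl) → refl }) (λ { refl → refl , refl , refl })
         (r ≟W r′ ×-dec y ℕ.≟ y′ ×-dec z ℕ.≟ z′)
  gnd _ _ _ ≟L vt _ _ _ = no λ ()
  gnd _ _ _ ≟L vv _ _ _ = no λ ()
  vt _ _ _ ≟L gnd _ _ _ = no λ ()
  vt _ _ _ ≟L vv _ _ _ = no λ ()
  vv _ _ _ ≟L gnd _ _ _ = no λ ()
  vv _ _ _ ≟L vt _ _ _ = no λ ()

  _≟T_ : DecidableEquality FTerm
  fvar a ≟T fvar b = map′ (cong fvar) (λ { refl → refl }) (a ℕ.≟ b)
  fcon a ≟T fcon b = map′ (cong fcon) (λ { refl → refl }) (a ℕ.≟ b)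
  fvar _ ≟T fcon _ = no λ ()
  fcon _ ≟T fvar _ = no λ ()

  _≟A_ : DecidableEquality Arg
  barg a ≟A barg b = map′ (cong barg) (λ { refl → refl }) (a ℕ.≟ b)
  farg s ≟A farg t = map′ (cong farg) (λ { refl → refl }) (s ≟T t)
  barg _ ≟A farg _ = no λ ()
  farg _ ≟A barg _ = no λ ()

  _≟F_ : DecidableEquality FAtom
  (s ≈ᶠ t) ≟F (s′ ≈ᶠ t′) = map′ (λ { (refl , refl) → refl }) (λ { refl → refl , refl }) (s ≟T s′ ×-dec t ≟T t′)
  app P as ≟F app P′ as′ =
    map′ (λ { (refl , refl) → refl }) (λ { refl → refl , refl }) (P ℕ.≟ P′ ×-dec List.≡-dec _≟A_ as as′)
  (_ ≈ᶠ _) ≟F app _ _ = no λ ()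
  app _ _ ≟F (_ ≈ᶠ _) = no λ ()

  _≟C_ : DecidableEquality Clause
  (l ‖ g ⇒ d) ≟C (l′ ‖ g′ ⇒ d′) =
    map′ (λ { (refl , refl , refl) → refl }) (λ { refl → refl , refl , refl })
         (List.≡-dec _≟L_ l l′ ×-dec List.≡-dec _≟F_ g g′ ×-dec List.≡-dec _≟F_ d d′)

  _≟V_ : DecidableEquality Var
  bv a ≟V bv b = map′ (cong bv) (λ { refl → refl }) (a ℕ.≟ b)
  fv a ≟V fv b = map′ (cong fv) (λ { refl → refl }) (a ℕ.≟ b)
  bv _ ≟V fv _ = no λ ()
  fv _ ≟V bv _ = no λ ()

  _≟S_ : DecidableEquality Sym
  pred a ≟S pred b = map′ (cong pred) (λ { refl → refl }) (a ℕ.≟ b)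
  falseV a ≟S falseV b = map′ (cong falseV) (λ { refl → refl }) (a ℕ.≟ b)
  pred _ ≟S falseV _ = no λ ()
  falseV _ ≟S pred _ = no λ ()

  _≟P_ : DecidableEquality Pos
  _≟P_ = Product.≡-dec _≟S_ ℕ._≟_

open SyntaxEquality

module Occurrences where

  VarInT? : ∀ v t → Dec (VarInT v t)
  VarInT? v (fvar w) = v ≟V fv w
  VarInT? v (fcon _) = no λ ()

  VarInArg? : ∀ v a → Dec (VarInArg v a)
  VarInArg? v (barg x) = v ≟V bv x
  VarInArg? v (farg t) = VarInT? v t

  VarInEq? : ∀ v a → Dec (VarInEq v a)
  VarInEq? v (s ≈ᶠ t) = VarInT? v s ⊎-dec VarInT? v t
  VarInEq? v (app _ _) = no λ ()

  VarInPred? : ∀ v a → Dec (VarInPred v a)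
  VarInPred? v (_ ≈ᶠ _) = no λ ()
  VarInPred? v (app _ as) = any? (VarInArg? v) as

  varsAt : ℕ → ℕ → FAtom → List Var
  varsAt P i (_ ≈ᶠ _) = []
  varsAt P i (app Q as) with P ℕ.≟ Q | as ‼ i
  ... | yes _ | just (barg y) = [ bv y ]
  ... | yes _ | just (farg (fvar w)) = [ fv w ]
  ... | _ | _ = []

  varsAt-sound : ∀ P i a {u} → u ∈ varsAt P i a → ∃ λ as → a ≡ app P as × as ‼ i ≡ just (varArg u)
  varsAt-sound P i (app Q as) u∈ with P ℕ.≟ Q | as ‼ i in e
  varsAt-sound P i (app Q as) (here refl) | yes refl | just (barg y) = as , refl , e
  varsAt-sound P i (app Q as) (here refl) | yes refl | just (farg (fvar w)) = as , refl , e

  varsAt-complete : ∀ P i as u → as ‼ i ≡ just (varArg u) → u ∈ varsAt P i (app P as)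
  varsAt-complete P i as u e with P ℕ.≟ P | as ‼ i | e
  ... | no P≢P | _ | _ = ⊥-elim (P≢P refl)
  varsAt-complete P i as (bv _) e | yes _ | just _ | refl = here refl
  varsAt-complete P i as (fv _) e | yes _ | just _ | refl = here refl

  OccAt-pred⁻ : ∀ C P i {u} → u ∈ concatMap (varsAt P i) (atomsOf C) → OccAt C (pred P , i) u
  OccAt-pred⁻ C P i u∈ with find (∈-concatMap⁻ (varsAt P i) {xs = atomsOf C} u∈)
  ... | a , a∈ , u∈a with varsAt-sound P i a u∈a
  ...   | as , refl , e = as , a∈ , e

  OccAt-pred⁺ : ∀ C P i {u} → OccAt C (pred P , i) u → u ∈ concatMap (varsAt P i) (atomsOf C)
  OccAt-pred⁺ C P i {u} (as , a∈ , e) = ∈-concatMap⁺ (varsAt P i) (lose a∈ (varsAt-complete P i as u e))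

  OccAt-falseV? : ∀ C w i → Dec (OccAt C (falseV w , i) (fv w))
  OccAt-falseV? C w i =
    yes refl ×-dec i ℕ.≟ 0 ×-dec any? (VarInEq? (fv w)) (atomsOf C) ×-dec ¬? (any? (VarInPred? (fv w)) (atomsOf C))

  ∃OccAt? : ∀ C q {R : Var → Set} → Decidable R → Dec (∃ λ u → OccAt C q u × R u)
  ∃OccAt? C (pred P , i) R? =
    map′ (λ (u , u∈ , r) → u , OccAt-pred⁻ C P i u∈ , r) (λ (u , o , r) → u , OccAt-pred⁺ C P i o , r) (∃∈? _ R?)
  ∃OccAt? C (falseV w , i) R? =
    map′ (λ (o , r) → fv w , o , r) (λ { (_ , o@(refl , _) , r) → o , r }) (OccAt-falseV? C w i ×-dec R? (fv w))

  VarInArg-bv : ∀ {y} a → VarInArg (bv y) a → a ≡ barg y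
  VarInArg-bv (barg _) refl = refl
  VarInArg-bv (farg (fvar _)) ()
  VarInArg-bv (farg (fcon _)) ()

  VarInPred⇒OccAt : ∀ D {y} → Any (VarInPred (bv y)) (atomsOf D) → ∃ λ q → OccAt D q (bv y)
  VarInPred⇒OccAt D y∈D with find y∈D
  ... | app P as , a∈ , y∈as with find y∈as
  ...   | b , b∈ , y≈b with refl ← VarInArg-bv b y≈b =
    let j , e = ∈-‼ b∈ in (pred P , j) , as , a∈ , e

  OccAt⇒VarInPred : ∀ {D q y} → OccAt D q (bv y) → Any (VarInPred (bv y)) (atomsOf D)
  OccAt⇒VarInPred {q = pred P , j} (as , a∈ , e) = lose a∈ (lose (‼-∈ as j e) refl)
  OccAt⇒VarInPred {q = falseV _ , _} (() , _)

  open DecMembership _≟L_ using () renaming (_∈?_ to _∈Λ?_)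
  open DecMembership _≟F_ using () renaming (_∈?_ to _∈F?_)

  Linked? : ∀ C u v → Dec (Linked C u v)
  Linked? C u v with u ≟V v
  ... | yes u≡v = yes (inj₁ u≡v)
  Linked? C (bv a) (bv b) | no u≢v =
    map′ (λ l → inj₂ (inj₁ (a , b , refl , refl , l)))
         (λ { (inj₁ u≡v) → ⊥-elim (u≢v u≡v)
            ; (inj₂ (inj₁ (_ , _ , refl , refl , l))) → l
            ; (inj₂ (inj₂ (_ , _ , () , _))) })
         (vv weq a b ∈Λ? Λ C ⊎-dec vv weq b a ∈Λ? Λ C ⊎-dec vv wle a b ∈Λ? Λ C ⊎-dec vv wge b a ∈Λ? Λ C)
  Linked? C (fv a) (fv b) | no u≢v =
    map′ (λ l → inj₂ (inj₂ (a , b , refl , refl , l)))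
         (λ { (inj₁ u≡v) → ⊥-elim (u≢v u≡v)
            ; (inj₂ (inj₁ (_ , _ , () , _)))
            ; (inj₂ (inj₂ (_ , _ , refl , refl , l))) → l })
         ((fvar a ≈ᶠ fvar b) ∈F? atomsOf C ⊎-dec (fvar b ≈ᶠ fvar a) ∈F? atomsOf C)
  Linked? C (bv a) (fv b) | no u≢v =
    no λ { (inj₁ u≡v) → u≢v u≡v ; (inj₂ (inj₁ (_ , _ , _ , () , _))) ; (inj₂ (inj₂ (_ , _ , () , _))) }
  Linked? C (fv a) (bv b) | no u≢v =
    no λ { (inj₁ u≡v) → u≢v u≡v ; (inj₂ (inj₁ (_ , _ , () , _))) ; (inj₂ (inj₂ (_ , _ , _ , () , _))) }

  falsePositions : FTerm → List Pos
  falsePositions (fvar w) = [ falseV w , 0 ]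
  falsePositions (fcon _) = []

  atomPositions : FAtom → List Pos
  atomPositions (app P as) = map (pred P ,_) (upTo (length as))
  atomPositions (s ≈ᶠ t) = falsePositions s ++ falsePositions t

  -- All positions of N, plus some spurious ⟨False_w, 0⟩; a finite vertex set for ⊑_N.
  positions : List Clause → List Pos
  positions = concatMap (concatMap atomPositions ∘ atomsOf)

  VarInEq⇒∈atomPositions : ∀ w a → VarInEq (fv w) a → (falseV w , 0) ∈ atomPositions a
  VarInEq⇒∈atomPositions w (fvar _ ≈ᶠ _) (inj₁ refl) = here refl
  VarInEq⇒∈atomPositions w (s ≈ᶠ fvar _) (inj₂ refl) = ∈-++⁺ʳ (falsePositions s) (here refl)

  OccAt⇒∈positions : ∀ {N C q v} → C ∈ N → OccAt C q v → q ∈ positions N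
  OccAt⇒∈positions {N} {C} C∈N o =
    ∈-concatMap⁺ _ {xs = N} (lose C∈N (∈-concatMap⁺ atomPositions {xs = atomsOf C} (q∈ _ o)))
    where
    q∈ : ∀ q {v} → OccAt C q v → Any ((q ∈_) ∘ atomPositions) (atomsOf C)
    q∈ (pred P , i) (as , a∈ , e) = lose a∈ (∈-map⁺ (pred P ,_) (∈-upTo⁺ (‼-length as i e)))
    q∈ (falseV w , _) (refl , refl , eq∈ , _) =
      let a , a∈ , w∈a = find eq∈ in lose a∈ (VarInEq⇒∈atomPositions w a w∈a)

module Ordering (N : List Clause) where
  open Occurrences

  Step? : ∀ q r → Dec (Step N q r)
  Step? q r =
    map′ (λ (C , C∈N , u , o , v , o′ , l) → C , C∈N , u , v , o , o′ , l)
         (λ (C , C∈N , u , v , o , o′ , l) → C , C∈N , u , o , v , o′ , l)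
         (∃∈? N λ C → ∃OccAt? C q λ u → ∃OccAt? C r λ v → Linked? C u v)

  _⊑?_ : ∀ q r → Dec (q ⊑[ N ] r)
  _⊑?_ = Star? (positions N) λ (C , C∈N , _ , _ , _ , o , _) → OccAt⇒∈positions C∈N o
    where open Reachability _≟P_ Step?

module Semantics where

  roundArgs : {A : Set} → (ℕ → ℤ → ℤ) → List (ℤ ⊎ A) → List (ℤ ⊎ A)
  roundArgs f [] = []
  roundArgs f (inj₁ a ∷ vs) = inj₁ (f 0 a) ∷ roundArgs (f ∘ suc) vs
  roundArgs f (inj₂ u ∷ vs) = inj₂ u ∷ roundArgs (f ∘ suc) vs

  ==⇒≡ : ∀ y x → (y == x) ≡ true → y ≡ x
  ==⇒≡ y x e = ≡ᵇ⇒≡ y x (subst T (sym e) tt)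

  relSem-irrelevant : ∀ I I′ r a b → relSem I r a b ≡ relSem I′ r a b
  relSem-irrelevant I I′ lt a b = refl
  relSem-irrelevant I I′ le a b = refl
  relSem-irrelevant I I′ eq a b = refl
  relSem-irrelevant I I′ ne a b = refl
  relSem-irrelevant I I′ ge a b = refl
  relSem-irrelevant I I′ gt a b = refl

  relSem-flipRel : ∀ I r a b → relSem I (flipRel r) a b ⇔ relSem I r b a
  relSem-flipRel I lt a b = mk⇔ id id
  relSem-flipRel I le a b = mk⇔ id id
  relSem-flipRel I eq a b = mk⇔ sym sym
  relSem-flipRel I ne a b = mk⇔ (_∘ sym) (_∘ sym)
  relSem-flipRel I ge a b = mk⇔ id id
  relSem-flipRel I gt a b = mk⇔ id id

  module _ {I I′ : Interp} where

    evalG-cong : ∀ t → (∀ c → ConstInG c t → evalC I c ≡ evalC I′ c) → evalG I t ≡ evalG I′ t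
    evalG-cong (con c) h = h c here
    evalG-cong (s ⊕ t) h = cong₂ ℤ._+_ (evalG-cong s (λ c → h c ∘ ⊕ˡ)) (evalG-cong t (λ c → h c ∘ ⊕ʳ))
    evalG-cong (s ⊖ t) h = cong₂ ℤ._-_ (evalG-cong s (λ c → h c ∘ ⊖ˡ)) (evalG-cong t (λ c → h c ∘ ⊖ʳ))
    evalG-cong (⊝ s) h = cong ℤ.-_ (evalG-cong s (λ c → h c ∘ ⊝∙))

    ⟦⟧L-cong : ∀ β γ γ′ l → (∀ c → ConstInL c l → evalC I c ≡ evalC I′ c) → ⟦_⟧L I β γ l ≡ ⟦_⟧L I′ β γ′ l
    ⟦⟧L-cong β γ γ′ (gnd r s t) h =
      trans (cong₂ (relSem I r) (evalG-cong s (λ c → h c ∘ inj₁)) (evalG-cong t (λ c → h c ∘ inj₂)))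
            (relSem-irrelevant I I′ r _ _)
    ⟦⟧L-cong β γ γ′ (vt r y t) h = trans (cong (relSem I r (β y)) (evalG-cong t h)) (relSem-irrelevant I I′ r _ _)
    ⟦⟧L-cong β γ γ′ (vv r y z) h = relSem-irrelevant I I′ (toRel r) _ _

  module _ (I : Interp) {β : ℕ → ℤ} {γ : ℕ → U I} {x : ℕ} {c : BConst} (βx≡c : β x ≡ evalC I c) where

    substL-correct : ∀ l → ⟦_⟧L I β γ (substL x c l) ⇔ ⟦_⟧L I β γ l
    substL-correct (gnd r s t) = mk⇔ id id
    substL-correct (vt r y t) with y == x in e
    ... | true with refl ← ==⇒≡ y x e =
      mk⇔ (subst (λ v → relSem I r v (evalG I t)) (sym βx≡c)) (subst (λ v → relSem I r v (evalG I t)) βx≡c)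
    ... | false = mk⇔ id id
    substL-correct (vv r y z) with y == x in e₁ | z == x in e₂
    ... | true | true with refl ← ==⇒≡ y x e₁ with refl ← ==⇒≡ z x e₂ =
      mk⇔ (subst (λ v → relSem I (toRel r) v v) (sym βx≡c)) (subst (λ v → relSem I (toRel r) v v) βx≡c)
    ... | true | false with refl ← ==⇒≡ y x e₁ =
      mk⇔ (subst (λ v → relSem I (toRel r) v (β z)) (sym βx≡c) ∘ Equivalence.to flipped)
          (Equivalence.from flipped ∘ subst (λ v → relSem I (toRel r) v (β z)) βx≡c)
      where flipped = relSem-flipRel I (toRel r) (β z) (evalC I c)
    ... | false | true with refl ← ==⇒≡ z x e₂ =
      mk⇔ (subst (λ v → relSem I (toRel r) (β y) v) (sym βx≡c)) (subst (λ v → relSem I (toRel r) (β y) v) βx≡c)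
    ... | false | false = mk⇔ id id

  module _ {I : Interp} {β : ℕ → ℤ} {γ : ℕ → U I} (C : Clause) (x : ℕ) (c : BConst) where

    instΛ⁺ : β x ≡ evalC I c → All (⟦_⟧L I β γ) (Λ C) → All (⟦_⟧L I β γ) (Λ (inst C x c))
    instΛ⁺ βx≡c hΛ =
      ++⁺ (map⁺ (All.map (λ {l} → Equivalence.from (substL-correct I {β} {γ} βx≡c l)) hΛ)) (βx≡c ∷ [])

    ClauseTrue-inst : ClauseTrue I β γ C → ClauseTrue I β γ (inst C x c)
    ClauseTrue-inst holds hΛ hΓ with ++⁻ (map (substL x c) (Λ C)) hΛ
    ... | hΛ′ , βx≡c ∷ [] =
      holds (All.map (λ {l} → Equivalence.to (substL-correct I {β} {γ} βx≡c l)) (map⁻ hΛ′)) hΓ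

  module Reinterpretation (I : Interp) (b : ℤ) (pr′ : ℕ → List (ℤ ⊎ U I) → Bool) where

    I′ : Interp
    I′ = record I { inf = b ; pr = pr′ }

    evalC-I′ : ∀ c → c ≢ c₊∞ → evalC I′ c ≡ evalC I c
    evalC-I′ (int _) _ = refl
    evalC-I′ (sk _) _ = refl
    evalC-I′ c₊∞ c≢c₊∞ = ⊥-elim (c≢c₊∞ refl)

    evalF-I′ : ∀ β β′ γ t → evalF I′ β γ t ≡ evalF I β′ γ t
    evalF-I′ β β′ γ (fvar _) = refl
    evalF-I′ β β′ γ (fcon _) = refl

    evalA-I′ : ∀ β γ a → evalA I′ β γ a ≡ evalA I β γ a
    evalA-I′ β γ (barg _) = refl
    evalA-I′ β γ (farg t) = cong inj₂ (evalF-I′ β β γ t)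

    ⟦≈⟧-I′ : ∀ β β′ γ s t → ⟦_⟧F I′ β γ (s ≈ᶠ t) ≡ ⟦_⟧F I β′ γ (s ≈ᶠ t)
    ⟦≈⟧-I′ β β′ γ s t = cong₂ _≡_ (evalF-I′ β β′ γ s) (evalF-I′ β β′ γ t)

    roundArgs-evalA : ∀ {β β′ γ} f as → (∀ j y → as ‼ j ≡ just (barg y) → f j (β y) ≡ β′ y) →
                      roundArgs f (map (evalA I′ β γ) as) ≡ map (evalA I β′ γ) as
    roundArgs-evalA f [] _ = refl
    roundArgs-evalA f (barg y ∷ as) h = cong₂ _∷_ (cong inj₁ (h 0 y refl)) (roundArgs-evalA (f ∘ suc) as (h ∘ suc))
    roundArgs-evalA {β} {β′} {γ} f (farg t ∷ as) h =
      cong₂ _∷_ (cong inj₂ (evalF-I′ β β′ γ t)) (roundArgs-evalA (f ∘ suc) as (h ∘ suc))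

  ClauseTrue-transfer : ∀ {I I′ β β′ γ γ′} D →
    (∀ {l} → l ∈ Λ D → ⟦_⟧L I β γ l → ⟦_⟧L I′ β′ γ′ l) →
    (∀ {a} → a ∈ Γ D → ⟦_⟧F I β γ a → ⟦_⟧F I′ β′ γ′ a) →
    (∀ {a} → a ∈ Δ D → ⟦_⟧F I′ β′ γ′ a → ⟦_⟧F I β γ a) →
    ClauseTrue I′ β′ γ′ D → ClauseTrue I β γ D
  ClauseTrue-transfer D Λ⇒ Γ⇒ Δ⇐ holds hΛ hΓ = Any-map∈ Δ⇐ (holds (All-map∈ Λ⇒ hΛ) (All-map∈ Γ⇒ hΓ))

open Semantics

module Constants where

  ConstInG? : ∀ c t → Dec (ConstInG c t)
  ConstInG? c (con c′) = map′ (λ { refl → here }) (λ { here → refl }) (c ≟B c′)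
  ConstInG? c (s ⊕ t) =
    map′ [ ⊕ˡ , ⊕ʳ ]′ (λ { (⊕ˡ o) → inj₁ o ; (⊕ʳ o) → inj₂ o }) (ConstInG? c s ⊎-dec ConstInG? c t)
  ConstInG? c (s ⊖ t) =
    map′ [ ⊖ˡ , ⊖ʳ ]′ (λ { (⊖ˡ o) → inj₁ o ; (⊖ʳ o) → inj₂ o }) (ConstInG? c s ⊎-dec ConstInG? c t)
  ConstInG? c (⊝ s) = map′ ⊝∙ (λ { (⊝∙ o) → o }) (ConstInG? c s)

  ConstInL? : ∀ c l → Dec (ConstInL c l)
  ConstInL? c (gnd _ s t) = ConstInG? c s ⊎-dec ConstInG? c t
  ConstInL? c (vt _ _ t) = ConstInG? c t
  ConstInL? c (vv _ _ _) = no λ ()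

  ConstOccurs? : ∀ c N → Dec (ConstOccurs c N)
  ConstOccurs? c N = ∃∈? N λ C → any? (ConstInL? c) (Λ C)

  module _ (I : Interp) where

    boundG : GTerm → ℤ
    boundG (con c) = evalC I c
    boundG (s ⊕ t) = boundG s ⊔ boundG t
    boundG (s ⊖ t) = boundG s ⊔ boundG t
    boundG (⊝ s) = boundG s

    boundG-≥ : ∀ {c} t → ConstInG c t → evalC I c ≤ boundG t
    boundG-≥ (con _) here = ≤-refl
    boundG-≥ (s ⊕ t) (⊕ˡ o) = ≤-trans (boundG-≥ s o) (ℤ.i≤i⊔j _ _)
    boundG-≥ (s ⊕ t) (⊕ʳ o) = ≤-trans (boundG-≥ t o) (ℤ.i≤j⊔i _ _)
    boundG-≥ (s ⊖ t) (⊖ˡ o) = ≤-trans (boundG-≥ s o) (ℤ.i≤i⊔j _ _)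
    boundG-≥ (s ⊖ t) (⊖ʳ o) = ≤-trans (boundG-≥ t o) (ℤ.i≤j⊔i _ _)
    boundG-≥ (⊝ s) (⊝∙ o) = boundG-≥ s o

    boundL : LAtom → ℤ
    boundL (gnd _ s t) = boundG s ⊔ boundG t
    boundL (vt _ _ t) = boundG t
    boundL (vv _ _ _) = 0ℤ

    boundL-≥ : ∀ {c} l → ConstInL c l → evalC I c ≤ boundL l
    boundL-≥ (gnd _ s t) (inj₁ o) = ≤-trans (boundG-≥ s o) (ℤ.i≤i⊔j _ _)
    boundL-≥ (gnd _ s t) (inj₂ o) = ≤-trans (boundG-≥ t o) (ℤ.i≤j⊔i _ _)
    boundL-≥ (vt _ _ t) o = boundG-≥ t o

    bound : List Clause → ℤ
    bound N = Extrema.max 0ℤ (map boundL (concatMap Λ N))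

    bound-≥ : ∀ {c} N → ConstOccurs c N → evalC I c ≤ bound N
    bound-≥ N (C , C∈N , occ) =
      let l , l∈ , o = find occ
      in ≤-trans (boundL-≥ l o)
                 (All.lookup (Extrema.xs≤max 0ℤ _) (∈-map⁺ boundL (∈-concatMap⁺ Λ {xs = N} (lose C∈N l∈))))

open Constants

module RaiseInfinity (I : Interp) (N : List Clause) (c₊∞∉N : ¬ ConstOccurs c₊∞ N) where
  open Reinterpretation I (ℤ.suc (bound I N)) (pr I) public

  ⟦⟧F-I′ : ∀ β γ a → ⟦_⟧F I′ β γ a ≡ ⟦_⟧F I β γ a
  ⟦⟧F-I′ β γ (s ≈ᶠ t) = ⟦≈⟧-I′ β β γ s t
  ⟦⟧F-I′ β γ (app P as) = cong (λ vs → pr I P vs ≡ true) (map-cong (evalA-I′ β γ) as)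

  Models-I′-N : Models I (setOf N) → Models I′ (setOf N)
  Models-I′-N ⊨N D D∈N β γ =
    ClauseTrue-transfer D Λ⇒ (λ {a} _ → subst id (⟦⟧F-I′ β γ a)) (λ {a} _ → subst id (sym (⟦⟧F-I′ β γ a)))
                        (⊨N D D∈N β γ)
    where
    Λ⇒ : ∀ {l} → l ∈ Λ D → ⟦_⟧L I′ β γ l → ⟦_⟧L I β γ l
    Λ⇒ {l} l∈ = subst id (⟦⟧L-cong β γ γ l λ c o → evalC-I′ c λ { refl → c₊∞∉N (D , D∈N , lose l∈ o) })

  Models-I′-Ψ : Models I′ (Ψ N)
  Models-I′-Ψ _ (c , occ , c≢c₊∞ , refl) β γ (∞≤c ∷ []) [] = ⊥-elim (ℤ.<-irrefl refl (ℤ.suc[i]≤j⇒i<j ∞≤bound))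
    where
    open ℤ.≤-Reasoning
    ∞≤bound : ℤ.suc (bound I N) ≤ bound I N
    ∞≤bound = begin
      ℤ.suc (bound I N) ≤⟨ ∞≤c ⟩
      evalC I′ c        ≡⟨ evalC-I′ c c≢c₊∞ ⟩
      evalC I c         ≤⟨ bound-≥ I N occ ⟩
      bound I N         ∎

module _ {N : List Clause} {C : Clause} (C∈N : C ∈ N) (x : ℕ) (p : Pos) where

  Models-N̂ : ∀ {I} → Models I (setOf N) → Models I (Ψ N) → Models I (N̂ N C x p)
  Models-N̂ ⊨N ⊨Ψ D (inj₁ (D∈N , _)) = ⊨N D D∈N
  Models-N̂ ⊨N ⊨Ψ D (inj₂ (inj₁ (c , _ , refl))) β γ = ClauseTrue-inst C x c (⊨N C C∈N β γ)
  Models-N̂ ⊨N ⊨Ψ D (inj₂ (inj₂ ψ)) = ⊨Ψ D ψ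

  N-sat⇒N̂-sat : (ConstOccurs c₊∞ N → ∀ D → Ψ N D → D ∈ N) →
                Satisfiable (setOf N) → Satisfiable (N̂ N C x p)
  N-sat⇒N̂-sat Ψ⊆N (I , ⊨N) with ConstOccurs? c₊∞ N
  ... | yes c₊∞∈N = I , Models-N̂ ⊨N λ D ψ → ⊨N D (Ψ⊆N c₊∞∈N D ψ)
  ... | no c₊∞∉N = I′ , Models-N̂ (Models-I′-N ⊨N) Models-I′-Ψ
    where open RaiseInfinity I N c₊∞∉N

module Rounding (N : List Clause) (M : Interp) where
  open Occurrences
  open Ordering N using (_⊑?_)
  open DecMembership _≟L_ using () renaming (_∈?_ to _∈Λ?_)

  IDual? : ∀ q d → Dec (IDual N q d)
  IDual? q d =
    map′ (λ { (C , C∈N , _ , o , x , refl , d∈Λ) → C , C∈N , x , o , d∈Λ })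
         (λ (C , C∈N , x , o , d∈Λ) → C , C∈N , bv x , o , x , refl , d∈Λ)
         (∃∈? N λ C → ∃OccAt? C q (upperBound? C))
    where
    upperBound? : ∀ C u → Dec (∃ λ x → u ≡ bv x × (vt eq x (con d) ∈ Λ C ⊎ vt le x (con d) ∈ Λ C))
    upperBound? C (bv x) = map′ (λ d∈Λ → x , refl , d∈Λ) (λ { (_ , refl , d∈Λ) → d∈Λ })
                                (vt eq x (con d) ∈Λ? Λ C ⊎-dec vt le x (con d) ∈Λ? Λ C)
    upperBound? C (fv _) = no λ { (_ , () , _) }

  varConstants : LAtom → List BConst
  varConstants (vt _ _ (con c)) = [ c ]
  varConstants _ = []

  candidates : List (Pos × BConst)
  candidates = cartesianProduct (positions N) (concatMap (concatMap varConstants ∘ Λ) N)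

  IDual⇒∈candidates : ∀ {q d} → IDual N q d → (q , d) ∈ candidates
  IDual⇒∈candidates {q} {d} (C , C∈N , x , o , d∈Λ) =
    ∈-cartesianProduct⁺ (OccAt⇒∈positions C∈N o)
                        (∈-concatMap⁺ _ {xs = N} (lose C∈N (∈-concatMap⁺ varConstants (d∈ d∈Λ))))
    where
    d∈ : vt eq x (con d) ∈ Λ C ⊎ vt le x (con d) ∈ Λ C → Any ((d ∈_) ∘ varConstants) (Λ C)
    d∈ (inj₁ l∈) = lose l∈ (here refl)
    d∈ (inj₂ l∈) = lose l∈ (here refl)

  Candidate : Pos → ℤ → Pos × BConst → Set
  Candidate q a (q′ , d) = q ⊑[ N ] q′ × IDual N q′ d × a ≤ evalC M d

  Candidate? : ∀ q a → Decidable (Candidate q a)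
  Candidate? q a (q′ , d) = q ⊑? q′ ×-dec IDual? q′ d ×-dec a ℤ.≤? evalC M d

  roundUp : Pos → ℤ → ℤ
  roundUp q a = least candidates
    where open Least (evalC M ∘ proj₂) (Candidate? q a) (inf M)

  module _ (q : Pos) (a : ℤ) where
    open Least (evalC M ∘ proj₂) (Candidate? q a) (inf M)

    roundUp-≤-inf : roundUp q a ≤ inf M
    roundUp-≤-inf = least-≤-top candidates

    roundUp-≤ : ∀ {q′ d} → q ⊑[ N ] q′ → IDual N q′ d → a ≤ evalC M d → roundUp q a ≤ evalC M d
    roundUp-≤ q⊑q′ dual a≤d = least-≤ candidates (IDual⇒∈candidates dual) (q⊑q′ , dual , a≤d)

    roundUp-attained : roundUp q a ≡ inf M ⊎
                       ∃₂ λ q′ d → q ⊑[ N ] q′ × IDual N q′ d × a ≤ evalC M d × roundUp q a ≡ evalC M d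
    roundUp-attained = map⊎ id (λ ((q′ , d) , _ , (q⊑q′ , dual , a≤d) , e) → q′ , d , q⊑q′ , dual , a≤d , e)
                            (least-attained candidates)

  roundUp-mono : ∀ {q q′ a a′} → q ⊑[ N ] q′ → a ≤ a′ → roundUp q a ≤ roundUp q′ a′
  roundUp-mono {q} {q′} {a} {a′} q⊑q′ a≤a′ with roundUp-attained q′ a′
  ... | inj₁ e = subst (roundUp q a ≤_) (sym e) (roundUp-≤-inf q a)
  ... | inj₂ (_ , _ , q′⊑q″ , dual , a′≤d , e) =
    subst (roundUp q a ≤_) (sym e) (roundUp-≤ q a (q⊑q′ ◅◅ q′⊑q″) dual (≤-trans a≤a′ a′≤d))

  roundUp-∈I↑ : ∀ q a → ∃ λ c → I↑ N q c × roundUp q a ≡ evalC M c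
  roundUp-∈I↑ q a with roundUp-attained q a
  ... | inj₁ e = c₊∞ , inj₁ refl , e
  ... | inj₂ (q′ , d , q⊑q′ , dual , _ , e) = d , inj₂ (q′ , q⊑q′ , dual) , e

  OccAt-⊑ : ∀ {D q q′ u} → D ∈ N → OccAt D q u → OccAt D q′ u → q ⊑[ N ] q′
  OccAt-⊑ D∈N o o′ = (_ , D∈N , _ , _ , o , o′ , inj₁ refl) ◅ ε

  roundedβ : Clause → (ℕ → ℤ) → ℕ → ℤ
  roundedβ D β y with any? (VarInPred? (bv y)) (atomsOf D)
  ... | yes y∈D = roundUp (proj₁ (VarInPred⇒OccAt D y∈D)) (β y)
  ... | no _ = β y

  roundedβ-at : ∀ {D q β y} → D ∈ N → OccAt D q (bv y) → roundedβ D β y ≡ roundUp q (β y)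
  roundedβ-at {D} {q} {β} {y} D∈N o with any? (VarInPred? (bv y)) (atomsOf D)
  ... | yes y∈D = let _ , o₀ = VarInPred⇒OccAt D y∈D in
    ≤-antisym (roundUp-mono (OccAt-⊑ D∈N o₀ o) ≤-refl) (roundUp-mono (OccAt-⊑ D∈N o o₀) ≤-refl)
  ... | no y∉D = ⊥-elim (y∉D (OccAt⇒VarInPred {D} o))

data NFView : LAtom → Set where
  ground   : ∀ {r s t} → NFView (gnd r s t)
  var≤con  : ∀ {y c} → NFView (vt le y (con c))
  var≡con  : ∀ {y c} → NFView (vt eq y (con c))
  var≥con  : ∀ {y c} → NFView (vt ge y (con c))
  var≤var  : ∀ {y z} → NFView (vv wle y z)
  var≥var  : ∀ {y z} → NFView (vv wge y z)

nfView : ∀ l → NFAtom l → NFView l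
nfView (gnd _ _ _) _ = ground
nfView (vt _ _ _) (inj₁ refl , _ , refl) = var≤con
nfView (vt _ _ _) (inj₂ (inj₁ refl) , _ , refl) = var≡con
nfView (vt _ _ _) (inj₂ (inj₂ refl) , _ , refl) = var≥con
nfView (vv _ _ _) (inj₁ refl) = var≤var
nfView (vv _ _ _) (inj₂ refl) = var≥var

module FromN̂ (N : List Clause) (nf : NormalForm N) {C : Clause} (C∈N : C ∈ N) {x P i : ℕ}
             (x-at : OccAt C (pred P , i) (bv x)) (M : Interp) (⊨N̂ : Models M (N̂ N C x (pred P , i))) where
  open NormalForm nf
  open Rounding N M
  open Occurrences using (VarInPred⇒OccAt)
  open Reinterpretation M (inf M) (λ Q → pr M Q ∘ roundArgs (λ k → roundUp (pred Q , k)))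
    renaming (I′ to M↑) public

  constant-<-inf : ∀ {c} → ConstOccurs c N → c ≢ c₊∞ → evalC M c ℤ.< inf M
  constant-<-inf {c} occ c≢c₊∞ = ℤ.≰⇒> λ ∞≤c →
    ¬Any[] (⊨N̂ (psi c) (inj₂ (inj₂ (c , occ , c≢c₊∞ , refl))) (λ _ → 0ℤ) (λ _ → u₀ M) (∞≤c ∷ []) [])

  constant-≤-inf : ∀ {c} → ConstOccurs c N → evalC M c ≤ inf M
  constant-≤-inf {c₊∞} _ = ≤-refl
  constant-≤-inf {int _} occ = ℤ.<⇒≤ (constant-<-inf occ λ ())
  constant-≤-inf {sk _} occ = ℤ.<⇒≤ (constant-<-inf occ λ ())

  evalC-M↑ : ∀ c → evalC M↑ c ≡ evalC M c
  evalC-M↑ (int _) = refl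
  evalC-M↑ (sk _) = refl
  evalC-M↑ c₊∞ = refl

  ≤-roundUp : ∀ {c} q {a} → ConstOccurs c N → evalC M c ≤ a → evalC M c ≤ roundUp q a
  ≤-roundUp {c} q {a} occ c≤a with roundUp-attained q a
  ... | inj₁ e = subst (evalC M c ≤_) (sym e) (constant-≤-inf occ)
  ... | inj₂ (_ , _ , _ , _ , a≤d , e) = subst (evalC M c ≤_) (sym e) (≤-trans c≤a a≤d)

  module _ {D : Clause} (D∈N : D ∈ N) {β : ℕ → ℤ} {γ : ℕ → U M} where

    Λ-rounded : ∀ {l} → l ∈ Λ D → ⟦_⟧L M β γ l → ⟦_⟧L M (roundedβ D β) γ l
    Λ-rounded {l} l∈ = go (nfView l (All.lookup (nfAtoms D D∈N) l∈))
      where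
      at : ∀ y → VarInL (bv y) l → ∃ λ q → OccAt D q (bv y)
      at y y∈l = VarInPred⇒OccAt D (nfVars D D∈N y (lose l∈ y∈l))

      step : ∀ {y z} → Linked D (bv y) (bv z) →
             (o : ∃ λ q → OccAt D q (bv y)) (o′ : ∃ λ q → OccAt D q (bv z)) → proj₁ o ⊑[ N ] proj₁ o′
      step link (_ , o) (_ , o′) = (D , D∈N , _ , _ , o , o′ , link) ◅ ε

      go : NFView l → ⟦_⟧L M β γ l → ⟦_⟧L M (roundedβ D β) γ l
      go ground h = h
      go (var≤con {y} {c}) h with at y refl
      ... | q , o =
        subst (_≤ evalC M c) (sym (roundedβ-at D∈N o)) (roundUp-≤ q (β y) ε (D , D∈N , y , o , inj₂ l∈) h)
      go (var≡con {y} {c}) h with at y refl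
      ... | q , o = trans (roundedβ-at D∈N o)
                      (≤-antisym (roundUp-≤ q (β y) ε (D , D∈N , y , o , inj₁ l∈) (≤-reflexive h))
                                 (≤-roundUp q (D , D∈N , lose l∈ here) (≤-reflexive (sym h))))
      go (var≥con {y} {c}) h with at y refl
      ... | q , o = subst (evalC M c ≤_) (sym (roundedβ-at D∈N o)) (≤-roundUp q (D , D∈N , lose l∈ here) h)
      go (var≤var {y} {z}) h with at y (inj₁ refl) | at z (inj₂ refl)
      ... | qy , oy | qz , oz =
        subst₂ _≤_ (sym (roundedβ-at D∈N oy)) (sym (roundedβ-at D∈N oz)) (roundUp-mono qy⊑qz h)
        where qy⊑qz = step (inj₂ (inj₁ (y , z , refl , refl , inj₂ (inj₂ (inj₁ l∈))))) (qy , oy) (qz , oz)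
      go (var≥var {y} {z}) h with at y (inj₁ refl) | at z (inj₂ refl)
      ... | qy , oy | qz , oz =
        subst₂ _≤_ (sym (roundedβ-at D∈N oz)) (sym (roundedβ-at D∈N oy)) (roundUp-mono qz⊑qy h)
        where qz⊑qy = step (inj₂ (inj₁ (z , y , refl , refl , inj₂ (inj₂ (inj₂ l∈))))) (qz , oz) (qy , oy)

    ⟦⟧F-M↑ : ∀ {a} → a ∈ atomsOf D → ⟦_⟧F M↑ β γ a ≡ ⟦_⟧F M (roundedβ D β) γ a
    ⟦⟧F-M↑ {s ≈ᶠ t} _ = ⟦≈⟧-I′ β (roundedβ D β) γ s t
    ⟦⟧F-M↑ {app Q as} a∈ =
      cong (λ vs → pr M Q vs ≡ true)
           (roundArgs-evalA _ as λ j y e → sym (roundedβ-at D∈N (as , a∈ , e)))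

    rounded-holds : ClauseTrue M (roundedβ D β) γ D
    rounded-holds with D ≟C C
    ... | no D≢C = ⊨N̂ D (inj₁ (D∈N , D≢C)) (roundedβ D β) γ
    ... | yes refl with roundUp-∈I↑ (pred P , i) (β x)
    ...   | c , c∈I↑ , e = λ hΛ → ⊨N̂ (inst C x c) (inj₂ (inj₁ (c , c∈I↑ , refl))) (roundedβ D β) γ
                                    (instΛ⁺ {M} {roundedβ D β} {γ} C x c (trans (roundedβ-at C∈N x-at) e) hΛ)

  Models-M↑ : Models M↑ (setOf N)
  Models-M↑ D D∈N β γ =
    ClauseTrue-transfer D (λ {l} l∈ → Λ-rounded D∈N {β} {γ} l∈ ∘ subst id (⟦⟧L-cong β γ γ l λ c _ → evalC-M↑ c))
                          (λ {a} a∈ → subst id (⟦⟧F-M↑ D∈N (∈-++⁺ˡ a∈)))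
                          (λ {a} a∈ → subst id (sym (⟦⟧F-M↑ D∈N (∈-++⁺ʳ (Γ D) a∈))))
                          (rounded-holds D∈N)

N̂-sat⇒N-sat : ∀ {N} → NormalForm N → ∀ {C} → C ∈ N → ∀ {x P i} → OccAt C (pred P , i) (bv x) →
              Satisfiable (N̂ N C x (pred P , i)) → Satisfiable (setOf N)
N̂-sat⇒N-sat nf C∈N x-at (M , ⊨N̂) = M↑ , Models-M↑
  where open FromN̂ _ nf C∈N x-at M ⊨N̂

lemma5 : (ar : ℕ → List Sort) (N : List Clause) →
         WellSorted ar N → NormalForm N →
         (ConstOccurs c₊∞ N → ∀ D → Ψ N D → D ∈ N) →
         (C : Clause) → C ∈ N →
         (x P i : ℕ) → OccAt C (pred P , i) (bv x) →
         Satisfiable (setOf N) ⇔ Satisfiable (N̂ N C x (pred P , i))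
lemma5 _ N _ nf Ψ⊆N C C∈N x P i x-at =
  mk⇔ (N-sat⇒N̂-sat C∈N x (pred P , i) Ψ⊆N) (N̂-sat⇒N-sat nf C∈N x-at)
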